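{- Let $\mathcal C$ be a hereditary class of graphs with infinite VC-dimension. For every bipartite graph $H=(H_\ell\cup H_r,E)$, at least one of the four graphs $H^{0,0},H^{1,0},H^{0,1},H^{1,1}$ belongs to $\mathcal C$.
   Context: A class of graphs is hereditary if it is closed under isomorphism and under taking induced subgraphs. The VC-dimension of a graph $G$ is the largest size of a set $X\subseteq V(G)$ such that for every $S\subseteq X$ some vertex $v$ satisfies $N[v]\cap X=S$ ($N[v]$ the closed neighbourhood); a class has infinite VC-dimension if these values are unbounded over the class. For a bipartite graph $H=(H_\ell\cup H_r,E)$: $H^{0,0}=H$; $H^{1,0}$ is obtained from $H$ by adding all edges inside $H_\ell$ (making it a clique); $H^{0,1}$ is obtained by adding all edges inside $H_r$; $H^{1,1}$ is obtained by adding all edges inside both $H_\ell$ and $H_r$. -}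

module Defs where

open import Data.Nat using (ℕ; _+_)
open import Data.Fin using (Fin; _≟_; splitAt)
open import Data.Bool using (Bool; true; false; _∧_; _∨_; not)
open import Data.Bool.Properties using (∧-zeroʳ)
open import Data.Sum using (_⊎_; inj₁; inj₂)
open import Data.Product using (Σ; ∃; _×_; _,_)
open import Function using (Inverse; Injection; _↔_; _↣_)
open import Relation.Nullary.Decidable using (⌊_⌋; yes; no)
open import Relation.Binary.PropositionalEquality using (_≡_; refl) renaming (sym to ≡-sym)

record Graph : Set where
  field
    n     : ℕ
    adj   : Fin n → Fin n → Bool
    adj-sym : ∀ x y → adj x y ≡ adj y x
    irrefl : ∀ x → adj x x ≡ false
open Graph public

record _≅_ (G G' : Graph) : Set where
  field
    bij      : Fin (n G) ↔ Fin (n G')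
    preserve : ∀ x y → adj G x y ≡ adj G' (Inverse.to bij x) (Inverse.to bij y)

induced : (G : Graph) {m : ℕ} → Fin m ↣ Fin (n G) → Graph
induced G {m} f = record
  { n = m
  ; adj = λ x y → adj G (Injection.to f x) (Injection.to f y)
  ; adj-sym = λ x y → adj-sym G (Injection.to f x) (Injection.to f y)
  ; irrefl = λ x → irrefl G (Injection.to f x)
  }

Class : Set₁
Class = Graph → Set

Hereditary : Class → Set
Hereditary C =
  (∀ G G' → G ≅ G' → C G → C G') ×
  (∀ G {m} (f : Fin m ↣ Fin (n G)) → C G → C (induced G f))

closedNbr : (G : Graph) → Fin (n G) → Fin (n G) → Bool
closedNbr G v x = ⌊ v ≟ x ⌋ ∨ adj G v x

-- A k-element set X ⊆ V(G) (given as an injection Fin k ↣ V(G)) is shattered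
-- if for every S ⊆ X (given by its indicator on Fin k) some vertex v has
-- N[v] ∩ X = S.
Shattered : (G : Graph) {k : ℕ} → Fin k ↣ Fin (n G) → Set
Shattered G {k} X =
  (S : Fin k → Bool) → Σ (Fin (n G)) λ v →
    ∀ i → closedNbr G v (Injection.to X i) ≡ S i

VCdim≥ : Graph → ℕ → Set
VCdim≥ G k = Σ (Fin k ↣ Fin (n G)) λ X → Shattered G X

InfiniteVC : Class → Set
InfiniteVC C = ∀ k → Σ Graph λ G → C G × VCdim≥ G k

record Bipartite : Set where
  field
    ℓ : ℕ
    r : ℕ
    E : Fin ℓ → Fin r → Bool
open Bipartite public

private
  neq : ∀ {m} → Fin m → Fin m → Bool
  neq i j = not ⌊ i ≟ j ⌋

  neq-sym : ∀ {m} (i j : Fin m) → neq i j ≡ neq j i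
  neq-sym i j with i ≟ j | j ≟ i
  ... | yes _ | yes _ = refl
  ... | no _  | no _  = refl
  ... | yes p | no q  with q (≡-sym p)
  ... | ()
  neq-sym i j | no q | yes p with q (≡-sym p)
  ... | ()

  neq-irr : ∀ {m} (i : Fin m) → neq i i ≡ false
  neq-irr i with i ≟ i
  ... | yes _ = refl
  ... | no q with q refl
  ... | ()

  adjSum : (a b : Bool) (H : Bipartite) → Fin (ℓ H) ⊎ Fin (r H) → Fin (ℓ H) ⊎ Fin (r H) → Bool
  adjSum a b H (inj₁ i) (inj₁ j) = a ∧ neq i j
  adjSum a b H (inj₂ i) (inj₂ j) = b ∧ neq i j
  adjSum a b H (inj₁ i) (inj₂ j) = E H i j
  adjSum a b H (inj₂ i) (inj₁ j) = E H j i

  adjSum-sym : ∀ a b H x y → adjSum a b H x y ≡ adjSum a b H y x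
  adjSum-sym a b H (inj₁ i) (inj₁ j) rewrite neq-sym i j = refl
  adjSum-sym a b H (inj₂ i) (inj₂ j) rewrite neq-sym i j = refl
  adjSum-sym a b H (inj₁ i) (inj₂ j) = refl
  adjSum-sym a b H (inj₂ i) (inj₁ j) = refl

  adjSum-irr : ∀ a b H x → adjSum a b H x x ≡ false
  adjSum-irr a b H (inj₁ i) rewrite neq-irr i = ∧-zeroʳ a
  adjSum-irr a b H (inj₂ i) rewrite neq-irr i = ∧-zeroʳ b

-- H^{a,b}: vertex set Fin (ℓ + r) (first ℓ vertices = H_ℓ, last r = H_r);
-- H_ℓ is made a clique iff a = true, H_r iff b = true; cross edges are E.
_^[_,_] : Bipartite → Bool → Bool → Graph
H ^[ a , b ] = record
  { n = ℓ H + r H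
  ; adj = λ x y → adjSum a b H (splitAt (ℓ H) x) (splitAt (ℓ H) y)
  ; adj-sym = λ x y → adjSum-sym a b H (splitAt (ℓ H) x) (splitAt (ℓ H) y)
  ; irrefl = λ x → adjSum-irr a b H (splitAt (ℓ H) x)
  }

-- Ramsey's theorem turns a large shattered set into a shattered set Y that is a
-- clique or an independent set.  A vertex of Y sees, inside Y, either only itself
-- or all of Y, so any vertex whose trace on Y omits one point and contains two is
-- outside Y.  Shattering Y yields such outside vertices w t for t < M = R(r, r),
-- pairwise distinct, whose traces on a set of "candidate" vertices of Y are
-- prescribed: for every map c from H_r to these indices and every i in H_ℓ there
-- is a candidate adjacent to w (c j) exactly when i j is an edge of H.  Ramsey
-- again picks r of the w t forming a clique or an independent set; with the
-- candidates belonging to that choice they induce H^{a,b}.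
module Submission where

open import Defs
open import Data.Nat using (ℕ; zero; suc; _+_; _*_; _^_; _≤_; s≤s)
open import Data.Nat.Properties using (≤-refl; _≤?_; ≰⇒>; <⇒≤; ≤-trans; +-monoˡ-≤; +-cancelˡ-≤; +-suc)
open import Data.Fin using (Fin; zero; suc; splitAt; _↑ˡ_; _↑ʳ_; combine; remQuot; funToFin; finToFun)
import Data.Fin as F
open import Data.Fin.Properties using (any?; +↔⊎; splitAt-↑ˡ; splitAt-↑ʳ; remQuot-combine; finToFun-funToFin)
open import Data.Bool using (Bool; true; false; _∨_)
open import Data.Bool.Properties using (_≟_; ∨-zeroʳ; ∧-zeroʳ; ∧-identityʳ; ¬-not)
open import Data.List using (List; []; _∷_; length; filter; allFin)
open import Data.List.Properties using (length-tabulate)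
open import Data.List.Membership.Propositional using (_∈_)
open import Data.List.Membership.Propositional.Properties using (∈-filter⁻)
open import Data.List.Relation.Binary.Subset.Propositional using (_⊆_)
open import Data.List.Relation.Unary.All using (All)
import Data.List.Relation.Unary.All as All
open import Data.List.Relation.Unary.AllPairs using (_∷_)
open import Data.List.Relation.Unary.Unique.Propositional using (Unique)
open import Data.List.Relation.Unary.Unique.Propositional.Properties using (allFin⁺; filter⁺)
open import Data.List.Relation.Unary.Any using (here; there)
open import Data.Sum using (_⊎_; inj₁; inj₂; [_,_]′)
open import Data.Product using (Σ; _×_; _,_; proj₁; proj₂; uncurry; map₂)
open import Function using (_∘_; id; case_of_; Injection; _↣_)
open import Function.Construct.Composition using (_↣-∘_)
open import Function.Construct.Identity using (↔-id)
open import Function.Bundles using (mk↣)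
open import Function.Properties.Inverse using (↔⇒↣)
open import Function.Definitions using (Injective)
open import Data.Empty using (⊥)
open import Relation.Nullary using (yes; no; contradiction)
open import Relation.Nullary.Decidable using (⌊_⌋; _×-dec_)
open import Relation.Binary.PropositionalEquality using (_≡_; _≢_; refl; sym; trans; cong; subst; module ≡-Reasoning)

ramseyBound : ℕ → ℕ → ℕ
ramseyBound zero    t       = 0
ramseyBound (suc s) zero    = 0
ramseyBound (suc s) (suc t) = suc (ramseyBound s (suc t) + ramseyBound (suc s) t)

+≤+⇒≤⊎≤ : ∀ p q m n → p + q ≤ m + n → p ≤ m ⊎ q ≤ n
+≤+⇒≤⊎≤ p q m n p+q≤m+n with p ≤? m
... | yes p≤m = inj₁ p≤m
... | no  p≰m = inj₂ (+-cancelˡ-≤ m q n (≤-trans (+-monoˡ-≤ q (<⇒≤ (≰⇒> p≰m))) p+q≤m+n))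

module Ramsey {A : Set} (c : A → A → Bool) (c-sym : ∀ x y → c x y ≡ c y x) where

  record Monochromatic (col : Bool) (m : ℕ) (xs : List A) : Set where
    field
      vertex    : Fin m → A
      injective : Injective _≡_ _≡_ vertex
      vertex∈   : ∀ i → vertex i ∈ xs
      colour    : ∀ {i j} → i ≢ j → c (vertex i) (vertex j) ≡ col

  neighbours : Bool → A → List A → List A
  neighbours col x = filter (λ y → c x y ≟ col)

  neighbours⊆ : ∀ col x xs → neighbours col x xs ⊆ x ∷ xs
  neighbours⊆ col x xs = there ∘ proj₁ ∘ ∈-filter⁻ (λ y → c x y ≟ col)

  length-neighbours : ∀ x xs →
    length (neighbours true x xs) + length (neighbours false x xs) ≡ length xs
  length-neighbours x []       = refl
  length-neighbours x (y ∷ xs) with c x y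
  ... | true  = cong suc (length-neighbours x xs)
  ... | false = trans (+-suc _ _) (cong suc (length-neighbours x xs))

  monochromatic-[] : ∀ {col xs} → Monochromatic col 0 xs
  monochromatic-[] = record { vertex = λ () ; injective = λ { {()} } ; vertex∈ = λ () ; colour = λ { {()} } }

  widen : ∀ {col m xs ys} → xs ⊆ ys → Monochromatic col m xs → Monochromatic col m ys
  widen xs⊆ys mono = record
    { vertex = vertex ; injective = injective ; vertex∈ = xs⊆ys ∘ vertex∈ ; colour = colour }
    where open Monochromatic mono

  extend : ∀ {col m x xs} → All (x ≢_) xs →
           Monochromatic col m (neighbours col x xs) → Monochromatic col (suc m) (x ∷ xs)
  extend {col} {m} {x} {xs} x∉xs mono = record
    { vertex = vertex′ ; injective = injective′ ; vertex∈ = vertex∈′ ; colour = colour′ }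
    where
    open Monochromatic mono
    vertex′ : Fin (suc m) → A
    vertex′ zero    = x
    vertex′ (suc i) = vertex i
    adjacent : ∀ i → vertex i ∈ xs × c x (vertex i) ≡ col
    adjacent = ∈-filter⁻ (λ y → c x y ≟ col) ∘ vertex∈
    x≢vertex : ∀ i → x ≢ vertex i
    x≢vertex i = All.lookup x∉xs (proj₁ (adjacent i))
    injective′ : Injective _≡_ _≡_ vertex′
    injective′ {zero}  {zero}  _ = refl
    injective′ {zero}  {suc j} e = contradiction e (x≢vertex j)
    injective′ {suc i} {zero}  e = contradiction (sym e) (x≢vertex i)
    injective′ {suc i} {suc j} e = cong suc (injective e)
    vertex∈′ : ∀ i → vertex′ i ∈ x ∷ xs
    vertex∈′ zero    = here refl
    vertex∈′ (suc i) = there (proj₁ (adjacent i))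
    colour′ : ∀ {i j} → i ≢ j → c (vertex′ i) (vertex′ j) ≡ col
    colour′ {zero}  {zero}  i≢j = contradiction refl i≢j
    colour′ {zero}  {suc j} _   = proj₂ (adjacent j)
    colour′ {suc i} {zero}  _   = trans (c-sym _ x) (proj₂ (adjacent i))
    colour′ {suc i} {suc j} i≢j = colour (i≢j ∘ cong suc)

  ramsey : ∀ s t xs → Unique xs → ramseyBound s t ≤ length xs →
           Monochromatic true s xs ⊎ Monochromatic false t xs
  ramsey zero    t       xs       _            _           = inj₁ monochromatic-[]
  ramsey (suc s) zero    xs       _            _           = inj₂ monochromatic-[]
  ramsey (suc s) (suc t) (x ∷ xs) (x∉xs ∷ uxs) (s≤s bound)
    with +≤+⇒≤⊎≤ (ramseyBound s (suc t)) (ramseyBound (suc s) t) _ _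
           (subst (_ ≤_) (sym (length-neighbours x xs)) bound)
  ... | inj₁ reds with ramsey s (suc t) (neighbours true x xs) (filter⁺ _ uxs) reds
  ...   | inj₁ red  = inj₁ (extend x∉xs red)
  ...   | inj₂ blue = inj₂ (widen (neighbours⊆ true x xs) blue)
  ramsey (suc s) (suc t) (x ∷ xs) (x∉xs ∷ uxs) (s≤s bound)
      | inj₂ blues with ramsey (suc s) t (neighbours false x xs) (filter⁺ _ uxs) blues
  ...   | inj₁ red  = inj₁ (widen (neighbours⊆ false x xs) red)
  ...   | inj₂ blue = inj₂ (extend x∉xs blue)

  ramsey-diagonal : ∀ m xs → Unique xs → ramseyBound m m ≤ length xs →
                    Σ Bool λ col → Monochromatic col m xs
  ramsey-diagonal m xs uxs bound with ramsey m m xs uxs bound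
  ... | inj₁ red  = true , red
  ... | inj₂ blue = false , blue

Homogeneous : (G : Graph) → Bool → ∀ {m} → (Fin m → Fin (n G)) → Set
Homogeneous G col Y = ∀ {i j} → i ≢ j → adj G (Y i) (Y j) ≡ col

homogeneous-subfamily : (G : Graph) {N : ℕ} (Z : Fin N → Fin (n G)) (m : ℕ) →
  ramseyBound m m ≤ N →
  Σ Bool λ col → Σ (Fin m → Fin N) λ f → Injective _≡_ _≡_ f × Homogeneous G col (Z ∘ f)
homogeneous-subfamily G {N} Z m bound = col , vertex , injective , colour
  where
  open Ramsey (λ p q → adj G (Z p) (Z q)) (λ p q → adj-sym G (Z p) (Z q))
  diagonal : Σ Bool λ col → Monochromatic col m (allFin N)
  diagonal = ramsey-diagonal m (allFin N) (allFin⁺ N) (subst (_ ≤_) (sym (length-tabulate id)) bound)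
  col : Bool
  col = proj₁ diagonal
  open Monochromatic (proj₂ diagonal)

shattered-∘ : (G : Graph) {N K : ℕ} (X : Fin N ↣ Fin (n G)) (f : Fin K ↣ Fin N) →
              Shattered G X → Shattered G (X ↣-∘ f)
shattered-∘ G {N} X f shattered S =
  map₂ (λ realises q → trans (realises (to f q)) (extension-to q)) (shattered extension)
  where
  open Injection using (to)
  extension : Fin N → Bool
  extension p with any? (λ q → to f q F.≟ p)
  ... | yes (q , _) = S q
  ... | no _        = false
  extension-to : ∀ q → extension (to f q) ≡ S q
  extension-to q with any? (λ q′ → to f q′ F.≟ to f q)
  ... | yes (q′ , fq′≡fq) = cong S (Injection.injective f fq′≡fq)
  ... | no ∄q′            = contradiction (q , refl) ∄q′

homogeneous-shattered : (G : Graph) {K : ℕ} → VCdim≥ G (ramseyBound K K) →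
  Σ Bool λ col → Σ (Fin K ↣ Fin (n G)) λ Y → Shattered G Y × Homogeneous G col (Injection.to Y)
homogeneous-shattered G {K} (X , X-shattered)
  with homogeneous-subfamily G (Injection.to X) K ≤-refl
... | col , f , f-injective , homogeneous =
  col , X ↣-∘ mk↣ f-injective , shattered-∘ G X (mk↣ f-injective) X-shattered , homogeneous

closedNbr-self : (G : Graph) (v : Fin (n G)) → closedNbr G v v ≡ true
closedNbr-self G v with v F.≟ v
... | yes _  = refl
... | no v≢v = contradiction refl v≢v

closedNbr-≢ : (G : Graph) {v x : Fin (n G)} → v ≢ x → closedNbr G v x ≡ adj G v x
closedNbr-≢ G {v} {x} v≢x with v F.≟ x
... | yes v≡x = contradiction v≡x v≢x
... | no _    = refl

-- ⌊ q ≟ p ⌋ ∨ col is the trace on a homogeneous family of its q-th member (closedNbr-member).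
single-or-all : ∀ {K} (col : Bool) (q : Fin K) {z x y} → x ≢ y →
  ⌊ q F.≟ z ⌋ ∨ col ≡ false → ⌊ q F.≟ x ⌋ ∨ col ≡ true → ⌊ q F.≟ y ⌋ ∨ col ≡ true → ⊥
single-or-all true  q {z} _ z∉ _ _ rewrite ∨-zeroʳ ⌊ q F.≟ z ⌋ = case z∉ of λ ()
single-or-all false q {z} {x} {y} x≢y _ x∈ y∈ with q F.≟ x | q F.≟ y
... | yes refl | yes refl = x≢y refl
... | no _     | _        = case x∈ of λ ()
... | yes _    | no _     = case y∈ of λ ()

module HomogeneousFamily (G : Graph) {K : ℕ} (Y : Fin K → Fin (n G))
       (Y-injective : Injective _≡_ _≡_ Y) {col : Bool} (homogeneous : Homogeneous G col Y) where

  closedNbr-member : ∀ q p → closedNbr G (Y q) (Y p) ≡ ⌊ q F.≟ p ⌋ ∨ col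
  closedNbr-member q p with q F.≟ p
  ... | yes refl = closedNbr-self G (Y q)
  ... | no q≢p   = trans (closedNbr-≢ G (q≢p ∘ Y-injective)) (homogeneous q≢p)

  realiser-∉ : ∀ {v : Fin (n G)} {S : Fin K → Bool} → (∀ p → closedNbr G v (Y p) ≡ S p) →
    ∀ {z x y} → x ≢ y → S z ≡ false → S x ≡ true → S y ≡ true → ∀ q → v ≢ Y q
  realiser-∉ {S = S} realises x≢y z∉ x∈ y∈ q refl =
    single-or-all col q x≢y (trace z∉) (trace x∈) (trace y∈)
    where
    trace : ∀ {p b} → S p ≡ b → ⌊ q F.≟ p ⌋ ∨ col ≡ b
    trace {p} Sp≡b = trans (sym (closedNbr-member q p)) (trans (realises p) Sp≡b)

record Realisation (G : Graph) (H : Bipartite) (a b : Bool) : Set where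
  field
    left              : Fin (ℓ H) → Fin (n G)
    right             : Fin (r H) → Fin (n G)
    left-injective    : Injective _≡_ _≡_ left
    right-injective   : Injective _≡_ _≡_ right
    left-homogeneous  : Homogeneous G a left
    right-homogeneous : Homogeneous G b right
    left≢right        : ∀ i j → left i ≢ right j
    cross             : ∀ i j → adj G (left i) (right j) ≡ E H i j

  vertex : Fin (ℓ H) ⊎ Fin (r H) → Fin (n G)
  vertex = [ left , right ]′

  vertex-injective : Injective _≡_ _≡_ vertex
  vertex-injective {inj₁ i} {inj₁ i′} e = cong inj₁ (left-injective e)
  vertex-injective {inj₂ j} {inj₂ j′} e = cong inj₂ (right-injective e)
  vertex-injective {inj₁ i} {inj₂ j}  e = contradiction e (left≢right i j)
  vertex-injective {inj₂ j} {inj₁ i}  e = contradiction (sym e) (left≢right i j)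

  embedding : Fin (ℓ H + r H) ↣ Fin (n G)
  embedding = mk↣ vertex-injective ↣-∘ ↔⇒↣ +↔⊎

  embedding-≅ : induced G embedding ≅ (H ^[ a , b ])
  embedding-≅ = record { bij = ↔-id _ ; preserve = preserve }
    where
    preserve : ∀ x y → adj G (Injection.to embedding x) (Injection.to embedding y) ≡ adj (H ^[ a , b ]) x y
    preserve x y with splitAt (ℓ H) x | splitAt (ℓ H) y
    ... | inj₁ i | inj₂ j = cross i j
    ... | inj₂ j | inj₁ i = trans (adj-sym G (right j) (left i)) (cross i j)
    ... | inj₁ i | inj₁ i′ with i F.≟ i′
    ...   | yes refl = trans (irrefl G (left i)) (sym (∧-zeroʳ a))
    ...   | no i≢i′  = trans (left-homogeneous i≢i′) (sym (∧-identityʳ a))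
    preserve x y | inj₂ j | inj₂ j′ with j F.≟ j′
    ...   | yes refl = trans (irrefl G (right j)) (sym (∧-zeroʳ b))
    ...   | no j≢j′  = trans (right-homogeneous j≢j′) (sym (∧-identityʳ b))

realisation-∈ : ∀ {C} → Hereditary C → ∀ {G H a b} → C G → Realisation G H a b → C (H ^[ a , b ])
realisation-∈ (closed-≅ , closed-induced) {G} CG R =
  closed-≅ _ _ embedding-≅ (closed-induced G embedding CG)
  where open Realisation R

isYes-any-unique : ∀ {R M} (c : Fin R → Fin M) (e : Fin R → Bool) {t j} → c j ≡ t →
  (∀ {j′} → c j′ ≡ t → j′ ≡ j) → ⌊ any? (λ j′ → c j′ F.≟ t ×-dec e j′ ≟ true) ⌋ ≡ e j
isYes-any-unique c e {t} {j} cj≡t unique with any? (λ j′ → c j′ F.≟ t ×-dec e j′ ≟ true)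
... | yes (j′ , cj′≡t , ej′) = sym (subst (λ k → e k ≡ true) (unique cj′≡t) ej′)
... | no ∄j′                 = sym (¬-not (λ ej → ∄j′ (j , cj≡t , ej)))

-- The roles indexing the homogeneous shattered set: a candidate (i, c) for each left
-- vertex i of H and each code c of a map Fin (r H) → Fin M, a marker for each t,
-- and two points top and bottom.  target t is the trace asked of the t-th witness:
-- it contains top and marker t but not bottom, which forces the witness outside the
-- set, and on (i, c) it is the H-neighbourhood of i read through c.
module Gadget (H : Bipartite) (M : ℕ) where

  candidates : ℕ
  candidates = ℓ H * M ^ r H

  size : ℕ
  size = candidates + (M + 2)

  data Role : Set where
    candidate  : Fin (ℓ H) → Fin (M ^ r H) → Role
    marker     : Fin M → Role
    top bottom : Role

  encode : Role → Fin size
  encode (candidate i c) = combine i c ↑ˡ (M + 2)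
  encode (marker s)      = candidates ↑ʳ (s ↑ˡ 2)
  encode top             = candidates ↑ʳ (M ↑ʳ zero)
  encode bottom          = candidates ↑ʳ (M ↑ʳ suc zero)

  decode : Fin size → Role
  decode q with splitAt candidates q
  ... | inj₁ x = uncurry candidate (remQuot (M ^ r H) x)
  ... | inj₂ y with splitAt M y
  ...   | inj₁ s       = marker s
  ...   | inj₂ zero    = top
  ...   | inj₂ (suc _) = bottom

  decode-encode : ∀ ρ → decode (encode ρ) ≡ ρ
  decode-encode (candidate i c) rewrite splitAt-↑ˡ candidates (combine i c) (M + 2) =
    cong (uncurry candidate) (remQuot-combine i c)
  decode-encode (marker s) rewrite splitAt-↑ʳ candidates (M + 2) (s ↑ˡ 2) | splitAt-↑ˡ M s 2 = refl
  decode-encode top rewrite splitAt-↑ʳ candidates (M + 2) (M ↑ʳ zero) | splitAt-↑ʳ M 2 (zero {1}) = refl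
  decode-encode bottom
    rewrite splitAt-↑ʳ candidates (M + 2) (M ↑ʳ suc zero) | splitAt-↑ʳ M 2 (suc (zero {0})) = refl

  candidate-injective : ∀ {i i′ c c′} → candidate i c ≡ candidate i′ c′ → i ≡ i′
  candidate-injective refl = refl

  encode-injective : Injective _≡_ _≡_ encode
  encode-injective {ρ} {σ} e = trans (sym (decode-encode ρ)) (trans (cong decode e) (decode-encode σ))

  target : Fin M → Role → Bool
  target t (candidate i c) = ⌊ any? (λ j → finToFun c j F.≟ t ×-dec E H i j ≟ true) ⌋
  target t (marker s)      = ⌊ s F.≟ t ⌋
  target t top             = true
  target t bottom          = false

  target-decode-encode : ∀ t ρ → target t (decode (encode ρ)) ≡ target t ρ
  target-decode-encode t ρ = cong (target t) (decode-encode ρ)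

  target-marker-self : ∀ t → target t (marker t) ≡ true
  target-marker-self t with t F.≟ t
  ... | yes _  = refl
  ... | no t≢t = contradiction refl t≢t

  target-marker : ∀ {s t} → target t (marker s) ≡ true → s ≡ t
  target-marker {s} {t} with s F.≟ t
  ... | yes s≡t = λ _ → s≡t
  ... | no _    = λ ()

  target-candidate : (g : Fin (r H) → Fin M) → Injective _≡_ _≡_ g →
                     ∀ i j → target (g j) (candidate i (funToFin g)) ≡ E H i j
  target-candidate g g-injective i j =
    isYes-any-unique (finToFun (funToFin g)) (E H i) (finToFun-funToFin g j)
      (λ {j′} c≡gj → g-injective (trans (sym (finToFun-funToFin g j′)) c≡gj))

module Construction (H : Bipartite) where

  M : ℕ
  M = ramseyBound (r H) (r H)

  open Gadget H M

  module _ (G : Graph) (Y↣ : Fin size ↣ Fin (n G)) (Y-shattered : Shattered G Y↣)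
           {a : Bool} (Y-homogeneous : Homogeneous G a (Injection.to Y↣)) where

    open Injection Y↣ using () renaming (to to Y; injective to Y-injective)
    open HomogeneousFamily G Y Y-injective Y-homogeneous

    witness : ∀ t → Σ (Fin (n G)) λ v → ∀ q → closedNbr G v (Y q) ≡ target t (decode q)
    witness t = Y-shattered (target t ∘ decode)

    w : Fin M → Fin (n G)
    w t = proj₁ (witness t)

    w-realises : ∀ t ρ → closedNbr G (w t) (Y (encode ρ)) ≡ target t ρ
    w-realises t ρ = trans (proj₂ (witness t) (encode ρ)) (target-decode-encode t ρ)

    w∉Y : ∀ t q → w t ≢ Y q
    w∉Y t = realiser-∉ (proj₂ (witness t)) {z = encode bottom} {encode top} {encode (marker t)}
      (λ e → case encode-injective {top} {marker t} e of λ ())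
      (target-decode-encode t bottom) (target-decode-encode t top)
      (trans (target-decode-encode t (marker t)) (target-marker-self t))

    w-injective : Injective _≡_ _≡_ w
    w-injective {s} {t} ws≡wt = target-marker (begin
      target t (marker s)                       ≡⟨ sym (w-realises t (marker s)) ⟩
      closedNbr G (w t) (Y (encode (marker s))) ≡⟨ cong (λ v → closedNbr G v _) ws≡wt ⟨
      closedNbr G (w s) (Y (encode (marker s))) ≡⟨ w-realises s (marker s) ⟩
      target s (marker s)                       ≡⟨ target-marker-self s ⟩
      true                                      ∎)
      where open ≡-Reasoning

    realisation : Σ Bool λ b → Realisation G H a b
    realisation with homogeneous-subfamily G w (r H) ≤-refl
    ... | b , h , h-injective , w∘h-homogeneous = b , record
      { left              = Y ∘ left-index
      ; right             = w ∘ h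
      ; left-injective    = left-index-injective ∘ Y-injective
      ; right-injective   = h-injective ∘ w-injective
      ; left-homogeneous  = λ i≢i′ → Y-homogeneous (i≢i′ ∘ left-index-injective)
      ; right-homogeneous = w∘h-homogeneous
      ; left≢right        = λ i j → w∉Y (h j) (left-index i) ∘ sym
      ; cross             = cross
      }
      where
      left-index : Fin (ℓ H) → Fin size
      left-index i = encode (candidate i (funToFin h))
      left-index-injective : Injective _≡_ _≡_ left-index
      left-index-injective = candidate-injective ∘ encode-injective
      cross : ∀ i j → adj G (Y (left-index i)) (w (h j)) ≡ E H i j
      cross i j = begin
        adj G (Y (left-index i)) (w (h j))              ≡⟨ adj-sym G _ _ ⟩
        adj G (w (h j)) (Y (left-index i))              ≡⟨ closedNbr-≢ G (w∉Y (h j) (left-index i)) ⟨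
        closedNbr G (w (h j)) (Y (left-index i))        ≡⟨ w-realises (h j) (candidate i (funToFin h)) ⟩
        target (h j) (candidate i (funToFin h))         ≡⟨ target-candidate h h-injective i j ⟩
        E H i j                                         ∎
        where open ≡-Reasoning

  bound : ℕ
  bound = ramseyBound size size

  VCdim≥⇒realisation : (G : Graph) → VCdim≥ G bound → Σ Bool λ a → Σ Bool λ b → Realisation G H a b
  VCdim≥⇒realisation G vc with homogeneous-shattered G vc
  ... | a , Y , Y-shattered , Y-homogeneous = a , realisation G Y Y-shattered Y-homogeneous

  variant-in : ∀ {C} → Hereditary C → (Σ Graph λ G → C G × VCdim≥ G bound) →
                Σ Bool λ a → Σ Bool λ b → C (H ^[ a , b ])
  variant-in hereditary (G , CG , vc) = map₂ (map₂ (realisation-∈ hereditary CG)) (VCdim≥⇒realisation G vc)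

one-of-four : (C : Class) (H : Bipartite) → (Σ Bool λ a → Σ Bool λ b → C (H ^[ a , b ])) →
    C (H ^[ false , false ]) ⊎ C (H ^[ true , false ]) ⊎ C (H ^[ false , true ]) ⊎ C (H ^[ true , true ])
one-of-four C H (false , false , c) = inj₁ c
one-of-four C H (true  , false , c) = inj₂ (inj₁ c)
one-of-four C H (false , true  , c) = inj₂ (inj₂ (inj₁ c))
one-of-four C H (true  , true  , c) = inj₂ (inj₂ (inj₂ c))

lemma5 : (C : Class) → Hereditary C → InfiniteVC C → (H : Bipartite) →
    C (H ^[ false , false ]) ⊎ C (H ^[ true , false ]) ⊎ C (H ^[ false , true ]) ⊎ C (H ^[ true , true ])
lemma5 C hereditary infinite H = one-of-four C H (variant-in hereditary (infinite bound))
  where open Construction H
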